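{- For every $n\ge1$, the Haken–Luby VCSP instance on the $7n$ variables $\{(k,i): k\in[n], i\in[7]\}$ is an oriented VCSP instance.
   Context: A binary Boolean VCSP instance $\mathcal{C}$ on a finite variable set $V$ is a collection of nonzero integer weights $c_S$ with scopes $S\subseteq V$, $|S|\le2$; write $c_i=c_{\{i\}}$, $c_{ij}=c_{\{i,j\}}$, with absent weights treated as $0$. It implements $f(x)=\sum_{c_S\in\mathcal{C}}c_S\prod_{j\in S}x_j$ on $x\in\{0,1\}^V$. Its constraint graph has an edge $\{i,j\}$ iff $c_{ij}\in\mathcal{C}$; $N(i)$ is the neighbourhood of $i$. Effective unary: $\hat c_i(x,S)=c_i+\sum_{j\in N(i)\setminus S}x_jc_{ij}$. Arcs $A(\mathcal{C})$: for each edge $\{i,j\}$, (1) the bidirected arc $i\leftrightarrow j$ is in $A(\mathcal{C})$ if there is an assignment $x$ with $|c_{ij}|>\max\{|\hat c_i(x,\{i,j\})|,|\hat c_j(x,\{i,j\})|\}$, $\mathrm{sgn}(c_{ij})\ne\mathrm{sgn}(\hat c_i(x,\{i,j\}))$ and $\mathrm{sgn}(c_{ij})\ne\mathrm{sgn}(\hat c_j(x,\{i,j\}))$; (2) otherwise, (a) $i\to j\in A(\mathcal{C})$ if some assignment $y$ has $|c_{ij}|>|\hat c_j(y,\{i,j\})|$ and $\mathrm{sgn}(c_{ij})\ne\mathrm{sgn}(\hat c_j(y,\{i,j\}))$, and (b) $j\to i\in A(\mathcal{C})$ if some assignment $z$ has $|c_{ij}|>|\hat c_i(z,\{i,j\})|$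 and $\mathrm{sgn}(c_{ij})\ne\mathrm{sgn}(\hat c_i(z,\{i,j\}))$. $\mathcal{C}$ is directed if $A(\mathcal{C})$ has no bidirected arcs, and oriented if it is directed and has at most one arc for each pair $i\ne j$. Haken–Luby instance: let $K=2n+1$, $M_k=\frac56(6^k-6)$, $\epsilon_k=n+1-k$. Unary weights: $c_{(k,1)}=-(6M_k+24)K$ for $k<n$ and $c_{(n,1)}=(6M_n+24)K$; $c_{(k,2)}=-(3M_k+10)K-\epsilon_k$; $c_{(k,3)}=-(3M_k+11)K$; $c_{(k,4)}=-(3M_k+9)K$; $c_{(k,5)}=-(2M_k+7)K$; $c_{(k,6)}=-(3M_k+9)K$; $c_{(k,7)}=-(M_k+1)K$. Binary weights for each $k\in[n]$: $c_{(k,1),(k,2)}=(3M_k+10)K+2\epsilon_k$; $c_{(k,1),(k,3)}=(3M_k+12)K$; $c_{(k,2),(k,4)}=(3M_k+10)K$; $c_{(k,3),(k,6)}=(3M_k+10)K$; $c_{(k,4),(k,5)}=(2M_k+6)K$; $c_{(k,6),(k,5)}=(2M_k+6)K$; $c_{(k,4),(k,7)}=(M_k+2)K$; $c_{(k,6),(k,7)}=(M_k+2)K$; $c_{(k,5),(k,7)}=-(2M_k+4)K$; and for $k\ge2$, $c_{(k,7),(k-1,1)}=M_kK$. No other weights are present. -}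

module Defs where

open import Data.Bool using (Bool; true; false; if_then_else_)
open import Data.Nat as ℕ using (ℕ; zero; suc; _∸_; _^_; _⊔_; _≡ᵇ_)
open import Data.Integer as ℤ using (ℤ; +_; -[1+_]; +[1+_]; 0ℤ; 1ℤ; -1ℤ; ∣_∣)
open import Data.Fin using (Fin; toℕ)
open import Data.Fin.Properties using () renaming (_≟_ to _≟ᶠ_)
open import Data.List using (List; []; _∷_; map; foldr; cartesianProduct; allFin; filter)
open import Data.Product using (_×_; _,_; Σ; ∃)
open import Data.Product.Properties using (≡-dec)
open import Relation.Nullary using (¬_; Dec; yes; no)
open import Relation.Nullary.Decidable using (⌊_⌋)
open import Relation.Binary.Definitions using (DecidableEquality)
open import Relation.Binary.PropositionalEquality using (_≡_; _≢_)

-- Absent weights are represented by 0 (present weights are nonzero),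
-- exactly as in the paper's convention "absent weights treated as 0".

record BVCSP (V : Set) : Set where
  field
    unary  : V → ℤ
    binary : V → V → ℤ

sgn : ℤ → ℤ
sgn (+ zero)   = 0ℤ
sgn +[1+ _ ]   = 1ℤ
sgn -[1+ _ ]   = -1ℤ

Assignment : Set → Set
Assignment V = V → Bool

bit : Bool → ℤ
bit true  = 1ℤ
bit false = 0ℤ

module VCSPNotions {V : Set} (_≟_ : DecidableEquality V) (vars : List V)
                   (C : BVCSP V) where
  open BVCSP C

  Edge : V → V → Set
  Edge i j = (i ≢ j) × (binary i j ≢ 0ℤ)

  -- effective unary  ĉ_i(x,{i,j}) = c_i + Σ_{l ∈ N(i) \ {i,j}} x_l c_il
  -- (summing over all l ∉ {i,j}; absent c_il are 0)
  notIn : V → V → V → Bool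
  notIn i j l = Data.Bool.not (⌊ l ≟ i ⌋ Data.Bool.∨ ⌊ l ≟ j ⌋)

  effUnary : Assignment V → V → V → ℤ
  effUnary x i j =
    unary i ℤ.+ foldr ℤ._+_ 0ℤ (map (λ l → bit (x l) ℤ.* binary i l)
                         (filter (λ l → Data.Bool.T? (notIn i j l)) vars))

  Bidir : V → V → Set
  Bidir i j = Edge i j × ∃ λ (x : Assignment V) →
      (∣ effUnary x i j ∣ ⊔ ∣ effUnary x j i ∣ ℕ.< ∣ binary i j ∣)
    × (sgn (binary i j) ≢ sgn (effUnary x i j))
    × (sgn (binary i j) ≢ sgn (effUnary x j i))

  Arc : V → V → Set
  Arc i j = Edge i j × ¬ Bidir i j × ∃ λ (y : Assignment V) →
      (∣ effUnary y j i ∣ ℕ.< ∣ binary i j ∣)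
    × (sgn (binary i j) ≢ sgn (effUnary y j i))

  Directed : Set
  Directed = ∀ i j → ¬ Bidir i j

  Oriented : Set
  Oriented = Directed × (∀ i j → i ≢ j → ¬ (Arc i j × Arc j i))

-- The Haken–Luby instance.  Variables (k,i) with k ∈ [n], i ∈ [7] are
-- represented by Fin n × Fin 7, with k = toℕ k + 1 and i = toℕ i + 1.

HLVar : ℕ → Set
HLVar n = Fin n × Fin 7

HLvars : (n : ℕ) → List (HLVar n)
HLvars n = cartesianProduct (allFin n) (allFin 7)

_≟HL_ : {n : ℕ} → DecidableEquality (HLVar n)
_≟HL_ = ≡-dec _≟ᶠ_ _≟ᶠ_

-- M_k = 5/6 (6^k - 6) = 5 (6^(k-1) - 1)   (for k ≥ 1)
M : ℕ → ℤ
M k = + (5 ℕ.* (6 ^ (k ∸ 1) ∸ 1))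

KK : ℕ → ℤ
KK n = + (2 ℕ.* n ℕ.+ 1)

eps : ℕ → ℕ → ℤ
eps n k = + (n ℕ.+ 1 ∸ k)

-- unary weight c_(k,i), k and i 1-based
HLunaryℕ : ℕ → ℕ → ℕ → ℤ
HLunaryℕ n k 1 = if k ≡ᵇ n then (+ 6 ℤ.* M k ℤ.+ + 24) ℤ.* KK n
                            else ℤ.- ((+ 6 ℤ.* M k ℤ.+ + 24) ℤ.* KK n)
HLunaryℕ n k 2 = ℤ.- ((+ 3 ℤ.* M k ℤ.+ + 10) ℤ.* KK n) ℤ.- eps n k
HLunaryℕ n k 3 = ℤ.- ((+ 3 ℤ.* M k ℤ.+ + 11) ℤ.* KK n)
HLunaryℕ n k 4 = ℤ.- ((+ 3 ℤ.* M k ℤ.+ + 9) ℤ.* KK n)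
HLunaryℕ n k 5 = ℤ.- ((+ 2 ℤ.* M k ℤ.+ + 7) ℤ.* KK n)
HLunaryℕ n k 6 = ℤ.- ((+ 3 ℤ.* M k ℤ.+ + 9) ℤ.* KK n)
HLunaryℕ n k 7 = ℤ.- ((M k ℤ.+ + 1) ℤ.* KK n)
HLunaryℕ n k _ = 0ℤ

-- binary weights inside block k, listed once per unordered pair
-- (ordered as in the paper), k, i, i' 1-based
HLlocal : ℕ → ℕ → ℕ → ℕ → ℤ
HLlocal n k 1 2 = (+ 3 ℤ.* M k ℤ.+ + 10) ℤ.* KK n ℤ.+ + 2 ℤ.* eps n k
HLlocal n k 1 3 = (+ 3 ℤ.* M k ℤ.+ + 12) ℤ.* KK n
HLlocal n k 2 4 = (+ 3 ℤ.* M k ℤ.+ + 10) ℤ.* KK n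
HLlocal n k 3 6 = (+ 3 ℤ.* M k ℤ.+ + 10) ℤ.* KK n
HLlocal n k 4 5 = (+ 2 ℤ.* M k ℤ.+ + 6) ℤ.* KK n
HLlocal n k 6 5 = (+ 2 ℤ.* M k ℤ.+ + 6) ℤ.* KK n
HLlocal n k 4 7 = (M k ℤ.+ + 2) ℤ.* KK n
HLlocal n k 6 7 = (M k ℤ.+ + 2) ℤ.* KK n
HLlocal n k 5 7 = ℤ.- ((+ 2 ℤ.* M k ℤ.+ + 4) ℤ.* KK n)
HLlocal n k _ _ = 0ℤ

-- one-directional table over (k,i),(k',i'), all 1-based;
-- includes c_(k,7),(k-1,1) = M_k K for k ≥ 2
HLtableℕ : ℕ → ℕ → ℕ → ℕ → ℕ → ℤ
HLtableℕ n k i k' i' =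
  if k ≡ᵇ k' then HLlocal n k i i'
  else (if (k ≡ᵇ suc k') Data.Bool.∧ (i ≡ᵇ 7) Data.Bool.∧ (i' ≡ᵇ 1)
        then M k ℤ.* KK n else 0ℤ)

HLtable : (n : ℕ) → HLVar n → HLVar n → ℤ
HLtable n (k , i) (k' , i') =
  HLtableℕ n (suc (toℕ k)) (suc (toℕ i)) (suc (toℕ k')) (suc (toℕ i'))

HakenLuby : (n : ℕ) → BVCSP (HLVar n)
HakenLuby n = record
  { unary  = λ { (k , i) → HLunaryℕ n (suc (toℕ k)) (suc (toℕ i)) }
  ; binary = λ u v → HLtable n u v ℤ.+ HLtable n v u
  }

IsOriented : (n : ℕ) → Set
IsOriented n = VCSPNotions.Oriented _≟HL_ (HLvars n) (HakenLuby n)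

module Submission where

-- Every edge {i, j} of the constraint graph has a stable endpoint i: for every assignment x the
-- effective unary ĉ_i(x, {i, j}) either has the sign of c_ij or is at least as large as c_ij in
-- absolute value, so j → i is never an arc. Hence no arc is bidirected and no pair carries arcs in
-- both directions. The stable endpoints are 1 on {1,2} and {1,3}, 2 on {2,4}, 3 on {3,6}, 4 on
-- {4,5} and {4,7}, 6 on {6,5} and {6,7}, 5 on {5,7}, and (k,7) on the edge to (k-1,1). Each ĉ_i
-- involves at most three neighbours, all weights are multiples of K up to the ε_k terms, the
-- neighbour (k+1,7) of (k,1) carries M_{k+1} K = (6 M_k + 25) K, and every case reduces to a linear
-- inequality in M_k ≥ 0, K > 0 and 0 < ε_k ≤ K.

open import Defs
open import Data.Bool using (Bool; true; false; if_then_else_; T; T?; not; _∨_)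
open import Data.Empty using (⊥; ⊥-elim)
open import Data.Fin as Fin using (Fin; zero; suc; toℕ; fromℕ<)
import Data.Fin.Properties as Fin
open import Data.Integer as ℤ using (ℤ; 0ℤ; +_; +[1+_]; -[1+_]; _+_; _-_; _*_; -_; ∣_∣; +≤+; +<+; -≤-)
import Data.Integer.Properties as ℤ
open import Algebra.Properties.CommutativeSemigroup ℤ.+-commutativeSemigroup using (x∙yz≈y∙xz)
open import Data.Integer.Tactic.RingSolver using (solve)
open import Data.List using (List; []; _∷_; _++_; map; foldr; foldl; filter)
open import Data.List.Properties using (foldl-++; foldl-map; foldl-cong; map-∘; map-id; map-++)
open import Data.List.Membership.Propositional using (_∈_; _∉_)
open import Data.List.Membership.Propositional.Properties
  using (∈-map⁺; ∈-filter⁺; ∈-allFin; ∈-cartesianProduct⁺)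
open import Data.List.Membership.DecPropositional (Fin._≟_ {7}) using (_∈?_)
open import Data.List.Relation.Binary.Subset.Propositional using (_⊆_)
open import Data.List.Relation.Unary.Any using (here; there)
import Data.List.Relation.Unary.AllPairs as AllPairs
import Data.List.Relation.Unary.AllPairs.Properties as AllPairs
open import Data.List.Relation.Unary.Unique.Propositional using (Unique; _∷_)
open import Data.List.Relation.Unary.Unique.Propositional.Properties
  using (Unique[x∷xs]⇒x∉xs; cartesianProduct⁺; allFin⁺)
open import Data.List.Relation.Unary.Unique.DecPropositional (Fin._≟_ {7}) using (unique?)
open import Data.Nat as ℕ using (ℕ; suc; _≤_; _≡ᵇ_; _∸_; _^_; z≤n; s≤s)
import Data.Nat.Properties as ℕ
open import Data.Nat.Tactic.RingSolver using (solve-∀)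
open import Data.Product using (_×_; _,_; proj₂; ∃)
open import Data.Sum using (_⊎_; inj₁; inj₂)
open import Function using (_∘_; case_of_)
open import Relation.Binary.Definitions using (DecidableEquality)
open import Relation.Binary.PropositionalEquality
open import Relation.Nullary using (¬_; yes; no; does; ¬?)
open import Relation.Nullary.Decidable using (⌊_⌋; True; toWitness; decidable-stable)

-- Integer sums over lists

sum : List ℤ → ℤ
sum = foldr _+_ 0ℤ

module _ {A : Set} where

  sum-filter : (p : A → Bool) (w : A → ℤ) (xs : List A) →
               sum (map w (filter (T? ∘ p) xs)) ≡ sum (map (λ l → if p l then w l else 0ℤ) xs)
  sum-filter p w []       = refl
  sum-filter p w (l ∷ xs) with p l
  ... | true  = cong (_+_ (w l)) (sum-filter p w xs)
  ... | false = trans (sum-filter p w xs) (sym (ℤ.+-identityˡ _))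

  sum-cong : ∀ {f g : A → ℤ} xs → (∀ {l} → l ∈ xs → f l ≡ g l) → sum (map f xs) ≡ sum (map g xs)
  sum-cong []       f≗g = refl
  sum-cong (l ∷ xs) f≗g = cong₂ _+_ (f≗g (here refl)) (sum-cong xs (f≗g ∘ there))

  sum-zero : ∀ {f : A → ℤ} xs → (∀ {l} → l ∈ xs → f l ≡ 0ℤ) → sum (map f xs) ≡ 0ℤ
  sum-zero []       f≗0 = refl
  sum-zero (l ∷ xs) f≗0 = cong₂ _+_ (f≗0 (here refl)) (sum-zero xs (f≗0 ∘ there))

  foldl-+-sum : (g : A → ℤ) (u : ℤ) (xs : List A) → foldl (λ s l → s + g l) u xs ≡ u + sum (map g xs)
  foldl-+-sum g u []       = sym (ℤ.+-identityʳ u)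
  foldl-+-sum g u (l ∷ xs) = trans (foldl-+-sum g (u + g l) xs) (ℤ.+-assoc u (g l) _)

module _ {A : Set} (_≟_ : DecidableEquality A) where

  zeroAt : A → (A → ℤ) → A → ℤ
  zeroAt s w l = if does (l ≟ s) then 0ℤ else w l

  zeroAt-≢ : ∀ {s l} (w : A → ℤ) → l ≢ s → zeroAt s w l ≡ w l
  zeroAt-≢ {s} {l} w l≢s with l ≟ s
  ... | yes l≡s = ⊥-elim (l≢s l≡s)
  ... | no  _   = refl

  zeroAt-≡ : ∀ s (w : A → ℤ) → zeroAt s w s ≡ 0ℤ
  zeroAt-≡ s w with s ≟ s
  ... | yes _   = refl
  ... | no  s≢s = ⊥-elim (s≢s refl)

  sum-zeroAt : ∀ {s} (w : A → ℤ) xs → s ∉ xs → sum (map (zeroAt s w) xs) ≡ sum (map w xs)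
  sum-zeroAt w xs s∉xs = sum-cong xs (λ l∈xs → zeroAt-≢ w (λ { refl → s∉xs l∈xs }))

  sum-extract : ∀ {s} (w : A → ℤ) {xs} → Unique xs → s ∈ xs →
                sum (map w xs) ≡ w s + sum (map (zeroAt s w) xs)
  sum-extract w {l ∷ xs} uniq (here refl) = cong (_+_ (w l)) (begin
    sum (map w xs)                            ≡⟨ sum-zeroAt w xs (Unique[x∷xs]⇒x∉xs uniq) ⟨
    sum (map (zeroAt l w) xs)                 ≡⟨ ℤ.+-identityˡ _ ⟨
    0ℤ + sum (map (zeroAt l w) xs)            ≡⟨ cong (_+ sum (map (zeroAt l w) xs)) (zeroAt-≡ l w) ⟨
    zeroAt l w l + sum (map (zeroAt l w) xs)  ∎)
    where open ≡-Reasoning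
  sum-extract {s} w {l ∷ xs} uniq@(_ ∷ uniq′) (there s∈xs) = begin
    w l + sum (map w xs)                      ≡⟨ cong (_+_ (w l)) (sum-extract w uniq′ s∈xs) ⟩
    w l + (w s + sum (map (zeroAt s w) xs))   ≡⟨ x∙yz≈y∙xz (w l) (w s) _ ⟩
    w s + (w l + sum (map (zeroAt s w) xs))   ≡⟨ cong (λ t → w s + (t + _)) (zeroAt-≢ w l≢s) ⟨
    w s + sum (map (zeroAt s w) (l ∷ xs))     ∎
    where
    open ≡-Reasoning
    l≢s : l ≢ s
    l≢s refl = Unique[x∷xs]⇒x∉xs uniq s∈xs

  sum-restrict : ∀ {xs N} (w : A → ℤ) → Unique xs → Unique N → N ⊆ xs → (∀ {l} → l ∉ N → w l ≡ 0ℤ) →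
                 sum (map w xs) ≡ sum (map w N)
  sum-restrict {xs} {[]}    w _ _ _ w≗0 = sum-zero xs (λ _ → w≗0 λ ())
  sum-restrict {xs} {s ∷ N} w uniq uniqN@(_ ∷ uniqN′) N⊆xs w≗0 = begin
    sum (map w xs)                   ≡⟨ sum-extract w uniq (N⊆xs (here refl)) ⟩
    w s + sum (map (zeroAt s w) xs)
      ≡⟨ cong (_+_ (w s)) (sum-restrict (zeroAt s w) uniq uniqN′ (N⊆xs ∘ there) vanishes) ⟩
    w s + sum (map (zeroAt s w) N)   ≡⟨ cong (_+_ (w s)) (sum-zeroAt w N (Unique[x∷xs]⇒x∉xs uniqN)) ⟩
    w s + sum (map w N)              ∎
    where
    open ≡-Reasoning
    vanishes : ∀ {l} → l ∉ N → zeroAt s w l ≡ 0ℤ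
    vanishes {l} l∉N with l ≟ s
    ... | yes _   = refl
    ... | no  l≢s = w≗0 λ { (here l≡s) → l≢s l≡s ; (there l∈N) → l∉N l∈N }

-- Binary weights that override effective unary weights

-- The paper's arc condition. A record rather than a product, so that c and v are determined by
-- unification against a goal ¬ Overrides c v.
record Overrides (c v : ℤ) : Set where
  constructor overrides
  field
    smaller      : ∣ v ∣ ℕ.< ∣ c ∣
    opposite-sgn : sgn c ≢ sgn v

¬overrides-same-sign : ∀ {c v} → 0ℤ ℤ.≤ c → 0ℤ ℤ.< v → ¬ Overrides c v
¬overrides-same-sign {+ 0}                 _ _        (overrides () _)
¬overrides-same-sign {+[1+ _ ]} {+ 0}      _ (+<+ ())
¬overrides-same-sign {+[1+ _ ]} {+[1+ _ ]} _ _        (overrides _ sgn≢) = sgn≢ refl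

¬overrides-dominated : ∀ {c v} → 0ℤ ℤ.≤ c → v ℤ.≤ - c → ¬ Overrides c v
¬overrides-dominated {+ 0}      {+ 0}       _ _         (overrides () _)
¬overrides-dominated {+ 0}      { -[1+ _ ]} _ _         (overrides () _)
¬overrides-dominated {+[1+ _ ]} { -[1+ _ ]} _ (-≤- c≤v) (overrides v<c _) =
  ℕ.<-irrefl refl (ℕ.≤-<-trans (s≤s c≤v) v<c)

sgn-neg : ∀ c → sgn (- c) ≡ - sgn c
sgn-neg (+ 0)    = refl
sgn-neg +[1+ _ ] = refl
sgn-neg -[1+ _ ] = refl

¬overrides-neg : ∀ {c v} → ¬ Overrides (- c) (- v) → ¬ Overrides c v
¬overrides-neg {c} {v} ¬ov (overrides v<c sgn≢) = ¬ov (overrides lt sgn≢′)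
  where
  lt : ∣ - v ∣ ℕ.< ∣ - c ∣
  lt rewrite ℤ.∣-i∣≡∣i∣ v | ℤ.∣-i∣≡∣i∣ c = v<c
  sgn≢′ : sgn (- c) ≢ sgn (- v)
  sgn≢′ eq = sgn≢ (ℤ.neg-injective (trans (sym (sgn-neg c)) (trans eq (sgn-neg v))))

-- The Overrides argument comes first: it fixes c and v before the ring solver elaborates the
-- identity passed last.
by-same-sign : ∀ {c v d} → Overrides c v → 0ℤ ℤ.≤ c → 0ℤ ℤ.< d → v ≡ d → ⊥
by-same-sign ov 0≤c 0<d refl = ¬overrides-same-sign 0≤c 0<d ov

by-domination : ∀ {c v d} → Overrides c v → 0ℤ ℤ.≤ c → 0ℤ ℤ.≤ d → v + d ≡ - c → ⊥
by-domination {c} {v} {d} ov 0≤c 0≤d v+d≡-c =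
  ¬overrides-dominated 0≤c (subst (v ℤ.≤_) v+d≡-c (ℤ.i≤i+j v d {{ℤ.nonNegative 0≤d}})) ov

*-nonNeg : ∀ {a b} → 0ℤ ℤ.≤ a → 0ℤ ℤ.≤ b → 0ℤ ℤ.≤ a * b
*-nonNeg {a} {b} 0≤a 0≤b = ℤ.*-monoʳ-≤-nonNeg b {{ℤ.nonNegative 0≤b}} 0≤a

*-pos : ∀ {a b} → 0ℤ ℤ.< a → 0ℤ ℤ.< b → 0ℤ ℤ.< a * b
*-pos {a} {b} 0<a 0<b = ℤ.*-monoʳ-<-pos b {{ℤ.positive 0<b}} 0<a

module EffectiveUnaryBounds (M K E : ℤ)
  (0≤M : 0ℤ ℤ.≤ M) (0<K : 0ℤ ℤ.< K) (0<E : 0ℤ ℤ.< E) (E≤K : E ℤ.≤ K) where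

  private
    0≤K = ℤ.<⇒≤ 0<K
    0≤E = ℤ.<⇒≤ 0<E

    0≤lin : ∀ α β → 0ℤ ℤ.≤ (+ α * M + + β) * K
    0≤lin α β = *-nonNeg {+ α * M + + β} (ℤ.+-mono-≤ (*-nonNeg {+ α} (+≤+ z≤n) 0≤M) (+≤+ z≤n)) 0≤K

    0<lin : ∀ α β → 0ℤ ℤ.< (+ α * M + +[1+ β ]) * K
    0<lin α β =
      *-pos {+ α * M + +[1+ β ]} (ℤ.+-mono-≤-< (*-nonNeg {+ α} (+≤+ z≤n) 0≤M) (+<+ (s≤s z≤n))) 0<K

    0≤2E : 0ℤ ℤ.≤ + 2 * E
    0≤2E = *-nonNeg {+ 2} (+≤+ z≤n) 0≤E

    -- ε ≤ K: the perturbation 2ε of c₁₂ never closes the gap 2K in the inner-block cases below.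
    0≤2[K-E] : 0ℤ ℤ.≤ + 2 * (K - E)
    0≤2[K-E] = *-nonNeg {+ 2} (+≤+ z≤n) (ℤ.i≤j⇒0≤j-i E≤K)

    0≤c₁₂ : 0ℤ ℤ.≤ (+ 3 * M + + 10) * K + + 2 * E
    0≤c₁₂ = ℤ.+-mono-≤ (0≤lin 3 10) 0≤2E

    0≤c₄₇ : 0ℤ ℤ.≤ (M + + 2) * K
    0≤c₄₇ = *-nonNeg {M + + 2} (ℤ.+-mono-≤ 0≤M (+≤+ z≤n)) 0≤K

    0≤MK : 0ℤ ℤ.≤ M * K
    0≤MK = *-nonNeg {M} 0≤M 0≤K

  -- ov is bound by a λ rather than a clause argument: the latter makes the solver calls much slower.
  no-override₁₂-last : ∀ x₃ → ¬ Overrides ((+ 3 * M + + 10) * K + + 2 * E)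
                                          ((+ 6 * M + + 24) * K + bit x₃ * ((+ 3 * M + + 12) * K))
  no-override₁₂-last false = λ ov → by-same-sign ov 0≤c₁₂ (0<lin 6 23) (solve (M ∷ K ∷ E ∷ []))
  no-override₁₂-last true  = λ ov → by-same-sign ov 0≤c₁₂ (0<lin 9 35) (solve (M ∷ K ∷ E ∷ []))

  no-override₁₂ : ∀ x₇ x₃ → ¬ Overrides ((+ 3 * M + + 10) * K + + 2 * E)
                                        (- ((+ 6 * M + + 24) * K) + bit x₇ * ((+ 6 * M + + 25) * K)
                                           + bit x₃ * ((+ 3 * M + + 12) * K))
  no-override₁₂ false false = λ ov →
    by-domination ov 0≤c₁₂ (ℤ.+-mono-≤ (0≤lin 3 12) 0≤2[K-E]) (solve (M ∷ K ∷ E ∷ []))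
  no-override₁₂ false true  = λ ov → by-domination ov 0≤c₁₂ 0≤2[K-E] (solve (M ∷ K ∷ E ∷ []))
  no-override₁₂ true  false = λ ov → by-same-sign ov 0≤c₁₂ (0<lin 0 0) (solve (M ∷ K ∷ E ∷ []))
  no-override₁₂ true  true  = λ ov → by-same-sign ov 0≤c₁₂ (0<lin 3 12) (solve (M ∷ K ∷ E ∷ []))

  no-override₁₃-last : ∀ x₂ → ¬ Overrides ((+ 3 * M + + 12) * K)
                                          ((+ 6 * M + + 24) * K
                                           + bit x₂ * ((+ 3 * M + + 10) * K + + 2 * E))
  no-override₁₃-last false = λ ov → by-same-sign ov (0≤lin 3 12) (0<lin 6 23) (solve (M ∷ K ∷ E ∷ []))
  no-override₁₃-last true  = λ ov →
    by-same-sign ov (0≤lin 3 12) (ℤ.+-mono-<-≤ (0<lin 9 33) 0≤2E) (solve (M ∷ K ∷ E ∷ []))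

  no-override₁₃ : ∀ x₇ x₂ → ¬ Overrides ((+ 3 * M + + 12) * K)
                                        (- ((+ 6 * M + + 24) * K) + bit x₇ * ((+ 6 * M + + 25) * K)
                                           + bit x₂ * ((+ 3 * M + + 10) * K + + 2 * E))
  no-override₁₃ false false = λ ov → by-domination ov (0≤lin 3 12) (0≤lin 3 12) (solve (M ∷ K ∷ E ∷ []))
  no-override₁₃ false true  = λ ov → by-domination ov (0≤lin 3 12) 0≤2[K-E] (solve (M ∷ K ∷ E ∷ []))
  no-override₁₃ true  false = λ ov → by-same-sign ov (0≤lin 3 12) (0<lin 0 0) (solve (M ∷ K ∷ E ∷ []))
  no-override₁₃ true  true  = λ ov →
    by-same-sign ov (0≤lin 3 12) (ℤ.+-mono-<-≤ (0<lin 3 10) 0≤2E) (solve (M ∷ K ∷ E ∷ []))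

  no-override₂₄ : ∀ x₁ → ¬ Overrides ((+ 3 * M + + 10) * K)
                                     (- ((+ 3 * M + + 10) * K) - E
                                      + bit x₁ * ((+ 3 * M + + 10) * K + + 2 * E))
  no-override₂₄ false = λ ov → by-domination ov (0≤lin 3 10) 0≤E (solve (M ∷ K ∷ E ∷ []))
  no-override₂₄ true  = λ ov → by-same-sign ov (0≤lin 3 10) 0<E (solve (M ∷ K ∷ E ∷ []))

  no-override₃₆ : ∀ x₁ → ¬ Overrides ((+ 3 * M + + 10) * K)
                                     (- ((+ 3 * M + + 11) * K) + bit x₁ * ((+ 3 * M + + 12) * K))
  no-override₃₆ false = λ ov → by-domination ov (0≤lin 3 10) 0≤K (solve (M ∷ K ∷ []))
  no-override₃₆ true  = λ ov → by-same-sign ov (0≤lin 3 10) 0<K (solve (M ∷ K ∷ []))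

  no-override₄₅ : ∀ x₂ x₇ → ¬ Overrides ((+ 2 * M + + 6) * K)
                                        (- ((+ 3 * M + + 9) * K) + bit x₂ * ((+ 3 * M + + 10) * K)
                                           + bit x₇ * ((M + + 2) * K))
  no-override₄₅ false false = λ ov → by-domination ov (0≤lin 2 6) (0≤lin 1 3) (solve (M ∷ K ∷ []))
  no-override₄₅ false true  = λ ov → by-domination ov (0≤lin 2 6) 0≤K (solve (M ∷ K ∷ []))
  no-override₄₅ true  false = λ ov → by-same-sign ov (0≤lin 2 6) 0<K (solve (M ∷ K ∷ []))
  no-override₄₅ true  true  = λ ov → by-same-sign ov (0≤lin 2 6) (0<lin 1 2) (solve (M ∷ K ∷ []))

  no-override₄₇ : ∀ x₂ x₅ → ¬ Overrides ((M + + 2) * K)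
                                        (- ((+ 3 * M + + 9) * K) + bit x₂ * ((+ 3 * M + + 10) * K)
                                           + bit x₅ * ((+ 2 * M + + 6) * K))
  no-override₄₇ false false = λ ov → by-domination ov 0≤c₄₇ (0≤lin 2 7) (solve (M ∷ K ∷ []))
  no-override₄₇ false true  = λ ov → by-domination ov 0≤c₄₇ 0≤K (solve (M ∷ K ∷ []))
  no-override₄₇ true  false = λ ov → by-same-sign ov 0≤c₄₇ 0<K (solve (M ∷ K ∷ []))
  no-override₄₇ true  true  = λ ov → by-same-sign ov 0≤c₄₇ (0<lin 2 6) (solve (M ∷ K ∷ []))

  no-override₅₇ : ∀ x₄ x₆ → ¬ Overrides (- ((+ 2 * M + + 4) * K))
                                        (- ((+ 2 * M + + 7) * K) + bit x₄ * ((+ 2 * M + + 6) * K)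
                                           + bit x₆ * ((+ 2 * M + + 6) * K))
  no-override₅₇ x₄ x₆ = ¬overrides-neg (negated x₄ x₆)
    where
    0≤--c : 0ℤ ℤ.≤ - - ((+ 2 * M + + 4) * K)
    0≤--c = subst (0ℤ ℤ.≤_) (sym (ℤ.neg-involutive _)) (0≤lin 2 4)

    negated : ∀ x₄ x₆ → ¬ Overrides (- - ((+ 2 * M + + 4) * K))
                                    (- (- ((+ 2 * M + + 7) * K) + bit x₄ * ((+ 2 * M + + 6) * K)
                                        + bit x₆ * ((+ 2 * M + + 6) * K)))
    negated false false = λ ov → by-same-sign ov 0≤--c (0<lin 2 6) (solve (M ∷ K ∷ []))
    negated false true  = λ ov → by-same-sign ov 0≤--c 0<K (solve (M ∷ K ∷ []))
    negated true  false = λ ov → by-same-sign ov 0≤--c 0<K (solve (M ∷ K ∷ []))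
    negated true  true  = λ ov → by-domination ov 0≤--c 0≤K (solve (M ∷ K ∷ []))

  no-override₇₁ : ∀ x₄ x₅ x₆ → ¬ Overrides (M * K)
                                          (- ((M + + 1) * K) + bit x₄ * ((M + + 2) * K)
                                             + bit x₅ * (- ((+ 2 * M + + 4) * K))
                                             + bit x₆ * ((M + + 2) * K))
  no-override₇₁ false false false = λ ov → by-domination ov 0≤MK 0≤K (solve (M ∷ K ∷ []))
  no-override₇₁ false false true  = λ ov → by-same-sign ov 0≤MK 0<K (solve (M ∷ K ∷ []))
  no-override₇₁ false true  false = λ ov → by-domination ov 0≤MK (0≤lin 2 5) (solve (M ∷ K ∷ []))
  no-override₇₁ false true  true  = λ ov → by-domination ov 0≤MK (0≤lin 1 3) (solve (M ∷ K ∷ []))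
  no-override₇₁ true  false false = λ ov → by-same-sign ov 0≤MK 0<K (solve (M ∷ K ∷ []))
  no-override₇₁ true  false true  = λ ov → by-same-sign ov 0≤MK (0<lin 1 2) (solve (M ∷ K ∷ []))
  no-override₇₁ true  true  false = λ ov → by-domination ov 0≤MK (0≤lin 1 3) (solve (M ∷ K ∷ []))
  no-override₇₁ true  true  true  = λ ov → by-domination ov 0≤MK 0≤K (solve (M ∷ K ∷ []))

-- Stable endpoints

module OrientationCriterion {V : Set} (_≟_ : DecidableEquality V) (vars : List V) (C : BVCSP V) where
  open VCSPNotions _≟_ vars C
  open BVCSP C

  -- No assignment makes j → i an arc.
  Stable : V → V → Set
  Stable i j = ∀ x → ¬ Overrides (binary i j) (effUnary x i j)

  oriented-if-stable-endpoints : (∀ i j → binary i j ≡ binary j i) →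
                                 (∀ i j → Edge i j → Stable i j ⊎ Stable j i) → Oriented
  oriented-if-stable-endpoints symmetric stable = directed , antisymmetric
    where
    stable-flipped : ∀ {i j} → Stable j i → ∀ x → ¬ Overrides (binary i j) (effUnary x j i)
    stable-flipped {i} {j} st x rewrite symmetric i j = st x

    directed : Directed
    directed i j (ij , x , lt , sgnᵢ , sgnⱼ) with stable i j ij
    ... | inj₁ st = st x (overrides (ℕ.m⊔n<o⇒m<o _ _ lt) sgnᵢ)
    ... | inj₂ st = stable-flipped st x (overrides (ℕ.m⊔n<o⇒n<o _ _ lt) sgnⱼ)

    antisymmetric : ∀ i j → i ≢ j → ¬ (Arc i j × Arc j i)
    antisymmetric i j _ ((ij , _ , y , lt , sgn≢) , (_ , _ , z , lt′ , sgn≢′)) with stable i j ij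
    ... | inj₁ st = stable-flipped st z (overrides lt′ sgn≢′)
    ... | inj₂ st = stable-flipped st y (overrides lt sgn≢)

  stable-from : ∀ i j {c} {v : Assignment V → ℤ} → binary i j ≡ c → (∀ x → effUnary x i j ≡ v x) →
                (∀ x → ¬ Overrides c (v x)) → Stable i j
  stable-from i j refl effUnary≡ bound x = subst (¬_ ∘ Overrides _) (sym (effUnary≡ x)) (bound x)

  RowSupport : V → List V → Set
  RowSupport i S = ∀ l → binary i l ≢ 0ℤ → l ∈ S

  private
    notIn-≢ : ∀ {i j l} → l ≢ i → l ≢ j → not (⌊ l ≟ i ⌋ ∨ ⌊ l ≟ j ⌋) ≡ true
    notIn-≢ {i} {j} {l} l≢i l≢j with l ≟ i | l ≟ j
    ... | yes l≡i | _       = ⊥-elim (l≢i l≡i)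
    ... | no _    | yes l≡j = ⊥-elim (l≢j l≡j)
    ... | no _    | no _    = refl

    notIn⇒≢ : ∀ {i j l} → not (⌊ l ≟ i ⌋ ∨ ⌊ l ≟ j ⌋) ≡ true → l ≢ j
    notIn⇒≢ {i} {j} {l} notIn l≡j with l ≟ i | l ≟ j
    ... | yes _ | _      = case notIn of λ ()
    ... | no _  | yes _  = case notIn of λ ()
    ... | no _  | no l≢j = l≢j l≡j

  effUnary-support : Unique vars → (∀ l → l ∈ vars) →
                     ∀ {i j N} → Unique (i ∷ j ∷ N) → RowSupport i (j ∷ N) →
                     ∀ x → effUnary x i j ≡ foldl (λ s l → s + bit (x l) * binary i l) (unary i) N
  effUnary-support uniqueVars complete {i} {j} {N} uniq@(_ ∷ uniq′@(_ ∷ uniqN)) support x = begin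
    unary i + sum (map g (filter (T? ∘ notIn i j) vars))
      ≡⟨ cong (_+_ (unary i)) (sum-filter (notIn i j) g vars) ⟩
    unary i + sum (map w vars)
      ≡⟨ cong (_+_ (unary i)) (sum-restrict _≟_ w uniqueVars uniqN (λ {l} _ → complete l) off-N) ⟩
    unary i + sum (map w N)
      ≡⟨ cong (_+_ (unary i)) (sum-cong N on-N) ⟩
    unary i + sum (map g N)
      ≡⟨ foldl-+-sum g (unary i) N ⟨
    foldl (λ s l → s + g l) (unary i) N ∎
    where
    open ≡-Reasoning
    g w : V → ℤ
    g l = bit (x l) * binary i l
    w l = if notIn i j l then g l else 0ℤ

    on-N : ∀ {l} → l ∈ N → w l ≡ g l
    on-N {l} l∈N rewrite notIn-≢ {i} {j} {l} (λ { refl → Unique[x∷xs]⇒x∉xs uniq (there l∈N) })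
                                            (λ { refl → Unique[x∷xs]⇒x∉xs uniq′ l∈N }) = refl

    off-N : ∀ {l} → l ∉ N → w l ≡ 0ℤ
    off-N {l} l∉N with notIn i j l in notIn≡
    ... | false = refl
    ... | true  = trans (cong (bit (x l) *_) c≡0) (ℤ.*-zeroʳ (bit (x l)))
      where
      c≡0 : binary i l ≡ 0ℤ
      c≡0 = decidable-stable (binary i l ℤ.≟ 0ℤ) λ c≢0 → case support l c≢0 of λ
        { (here l≡j) → notIn⇒≢ {i} {j} {l} notIn≡ l≡j ; (there l∈N) → l∉N l∈N }

-- The Haken–Luby instance

pattern p₁ = zero
pattern p₂ = suc zero
pattern p₃ = suc (suc zero)
pattern p₄ = suc (suc (suc zero))
pattern p₅ = suc (suc (suc (suc zero)))
pattern p₆ = suc (suc (suc (suc (suc zero))))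
pattern p₇ = suc (suc (suc (suc (suc (suc zero)))))

toℕ₁ : ∀ {m} → Fin m → ℕ
toℕ₁ i = suc (toℕ i)

toℕ₁-injective : ∀ {m} {a b : Fin m} → toℕ₁ a ≡ toℕ₁ b → a ≡ b
toℕ₁-injective = Fin.toℕ-injective ∘ ℕ.suc-injective

blockNeighbours : Fin 7 → List (Fin 7)
blockNeighbours p₁ = p₂ ∷ p₃ ∷ []
blockNeighbours p₂ = p₁ ∷ p₄ ∷ []
blockNeighbours p₃ = p₁ ∷ p₆ ∷ []
blockNeighbours p₄ = p₂ ∷ p₅ ∷ p₇ ∷ []
blockNeighbours p₅ = p₄ ∷ p₆ ∷ p₇ ∷ []
blockNeighbours p₆ = p₃ ∷ p₅ ∷ p₇ ∷ []
blockNeighbours p₇ = p₄ ∷ p₅ ∷ p₆ ∷ []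

otherNeighbours : Fin 7 → Fin 7 → List (Fin 7)
otherNeighbours a b = filter (λ b′ → ¬? (b′ Fin.≟ b)) (blockNeighbours a)

∈-otherNeighbours : ∀ {a b b′} → b′ ∈ blockNeighbours a → b′ ∈ b ∷ otherNeighbours a b
∈-otherNeighbours {b = b} {b′} b′∈ with b′ Fin.≟ b
... | yes refl = here refl
... | no  b′≢b = there (∈-filter⁺ (λ b″ → ¬? (b″ Fin.≟ b)) b′∈ b′≢b)

edgeWeight : ℕ → ℕ → Fin 7 → Fin 7 → ℤ
edgeWeight n k p₁ p₂ = HLlocal n k 1 2
edgeWeight n k p₂ p₁ = HLlocal n k 1 2
edgeWeight n k p₁ p₃ = HLlocal n k 1 3
edgeWeight n k p₃ p₁ = HLlocal n k 1 3
edgeWeight n k p₂ p₄ = HLlocal n k 2 4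
edgeWeight n k p₄ p₂ = HLlocal n k 2 4
edgeWeight n k p₃ p₆ = HLlocal n k 3 6
edgeWeight n k p₆ p₃ = HLlocal n k 3 6
edgeWeight n k p₄ p₅ = HLlocal n k 4 5
edgeWeight n k p₅ p₄ = HLlocal n k 4 5
edgeWeight n k p₆ p₅ = HLlocal n k 6 5
edgeWeight n k p₅ p₆ = HLlocal n k 6 5
edgeWeight n k p₄ p₇ = HLlocal n k 4 7
edgeWeight n k p₇ p₄ = HLlocal n k 4 7
edgeWeight n k p₆ p₇ = HLlocal n k 6 7
edgeWeight n k p₇ p₆ = HLlocal n k 6 7
edgeWeight n k p₅ p₇ = HLlocal n k 5 7
edgeWeight n k p₇ p₅ = HLlocal n k 5 7
edgeWeight n k _  _  = 0ℤ

-- Testing adjacency first makes blockWeight-support immediate; on block edges the value is the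
-- weight as written in the paper, without the + 0ℤ of the symmetrised table of Defs.
blockWeight : ℕ → ℕ → Fin 7 → Fin 7 → ℤ
blockWeight n k a b = if does (b ∈? blockNeighbours a) then edgeWeight n k a b else 0ℤ

blockWeight-support : ∀ {n k a b} → blockWeight n k a b ≢ 0ℤ → b ∈ blockNeighbours a
blockWeight-support {a = a} {b} w≢0 with b ∈? blockNeighbours a
... | yes b∈ = b∈
... | no  _  = ⊥-elim (w≢0 refl)

HLlocal-symmetrised : ∀ n k a b →
                      HLlocal n k (toℕ₁ a) (toℕ₁ b) + HLlocal n k (toℕ₁ b) (toℕ₁ a) ≡ blockWeight n k a b
HLlocal-symmetrised n k p₁ = λ { p₁ → refl ; p₂ → ℤ.+-identityʳ _ ; p₃ → ℤ.+-identityʳ _ ; p₄ → refl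
                              ; p₅ → refl ; p₆ → refl ; p₇ → refl }
HLlocal-symmetrised n k p₂ = λ { p₁ → ℤ.+-identityˡ _ ; p₂ → refl ; p₃ → refl ; p₄ → ℤ.+-identityʳ _
                              ; p₅ → refl ; p₆ → refl ; p₇ → refl }
HLlocal-symmetrised n k p₃ = λ { p₁ → ℤ.+-identityˡ _ ; p₂ → refl ; p₃ → refl ; p₄ → refl
                              ; p₅ → refl ; p₆ → ℤ.+-identityʳ _ ; p₇ → refl }
HLlocal-symmetrised n k p₄ = λ { p₁ → refl ; p₂ → ℤ.+-identityˡ _ ; p₃ → refl ; p₄ → refl
                              ; p₅ → ℤ.+-identityʳ _ ; p₆ → refl ; p₇ → ℤ.+-identityʳ _ }
HLlocal-symmetrised n k p₅ = λ { p₁ → refl ; p₂ → refl ; p₃ → refl ; p₄ → ℤ.+-identityˡ _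
                              ; p₅ → refl ; p₆ → ℤ.+-identityˡ _ ; p₇ → ℤ.+-identityʳ _ }
HLlocal-symmetrised n k p₆ = λ { p₁ → refl ; p₂ → refl ; p₃ → ℤ.+-identityˡ _ ; p₄ → refl
                              ; p₅ → ℤ.+-identityʳ _ ; p₆ → refl ; p₇ → ℤ.+-identityʳ _ }
HLlocal-symmetrised n k p₇ = λ { p₁ → refl ; p₂ → refl ; p₃ → refl ; p₄ → ℤ.+-identityˡ _
                              ; p₅ → ℤ.+-identityˡ _ ; p₆ → ℤ.+-identityˡ _ ; p₇ → refl }

≡ᵇ⇒≡ : ∀ {m m′} → (m ≡ᵇ m′) ≡ true → m ≡ m′
≡ᵇ⇒≡ {m} {m′} eq = ℕ.≡ᵇ⇒≡ m m′ (subst T (sym eq) _)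

≡ᵇ-refl : ∀ {m} → (m ≡ᵇ m) ≢ false
≡ᵇ-refl {m} eq = subst T eq (ℕ.≡⇒≡ᵇ m m refl)

HLtableℕ-within : ∀ n m i i′ → HLtableℕ n m i m i′ ≡ HLlocal n m i i′
HLtableℕ-within n m i i′ with m ≡ᵇ m in eq
... | true  = refl
... | false = ⊥-elim (≡ᵇ-refl {m} eq)

HLtableℕ-across-support : ∀ {n m m′ i i′} → m ≢ m′ → HLtableℕ n m i m′ i′ ≢ 0ℤ →
                          i ≡ 7 × i′ ≡ 1 × m ≡ suc m′
HLtableℕ-across-support {n} {m} {m′} {i} {i′} m≢m′ w≢0 with m ≡ᵇ m′ in eq
... | true  = ⊥-elim (m≢m′ (≡ᵇ⇒≡ eq))
... | false with m ≡ᵇ suc m′ in eq₁ | i ≡ᵇ 7 in eq₂ | i′ ≡ᵇ 1 in eq₃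
...   | true  | true  | true  = ≡ᵇ⇒≡ eq₂ , ≡ᵇ⇒≡ eq₃ , ≡ᵇ⇒≡ eq₁
...   | true  | true  | false = ⊥-elim (w≢0 refl)
...   | true  | false | _     = ⊥-elim (w≢0 refl)
...   | false | _     | _     = ⊥-elim (w≢0 refl)

HLtableℕ-down : ∀ n m → HLtableℕ n (suc m) 7 m 1 ≡ M (suc m) * KK n
HLtableℕ-down n m with suc m ≡ᵇ m in eq | m ≡ᵇ m in eq′
... | true  | _     = ⊥-elim (ℕ.1+n≢n (≡ᵇ⇒≡ {suc m} eq))
... | false | true  = refl
... | false | false = ⊥-elim (≡ᵇ-refl {m} eq′)

M-step : ∀ t → M (suc (suc t)) ≡ + 6 * M (suc t) + + 25
M-step t = trans (cong +_ (step (6 ^ t) (ℕ.m^n>0 6 t))) (cong (_+ + 25) (ℤ.pos-* 6 (5 ℕ.* (6 ^ t ∸ 1))))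
  where
  identity : ∀ q → 5 ℕ.* (q ℕ.+ 5 ℕ.* suc q) ≡ 6 ℕ.* (5 ℕ.* q) ℕ.+ 25
  identity = solve-∀
  step : ∀ p → 0 ℕ.< p → 5 ℕ.* (6 ℕ.* p ∸ 1) ≡ 6 ℕ.* (5 ℕ.* (p ∸ 1)) ℕ.+ 25
  step (suc q) _ = identity q

0<KK : ∀ n → 0ℤ ℤ.< KK n
0<KK n = +<+ (ℕ.m≤n+m 1 (2 ℕ.* n))

0<eps : ∀ {n} (k : Fin n) → 0ℤ ℤ.< eps n (toℕ₁ k)
0<eps {n} k = +<+ (ℕ.m<n⇒0<n∸m (subst (toℕ₁ k ℕ.<_) (ℕ.+-comm 1 n) (s≤s (Fin.toℕ<n k))))

eps≤KK : ∀ n m → eps n m ℤ.≤ KK n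
eps≤KK n m = +≤+ (ℕ.≤-trans (ℕ.m∸n≤m (n ℕ.+ 1) m) (ℕ.+-monoˡ-≤ 1 (ℕ.m≤m+n n (n ℕ.+ 0))))

last-or-successor : ∀ {n} (k : Fin n) → toℕ₁ k ≡ n ⊎ ∃ λ k⁺ → toℕ k⁺ ≡ toℕ₁ k
last-or-successor {n} k with toℕ₁ k ℕ.≟ n
... | yes last  = inj₁ last
... | no  ¬last = inj₂ (fromℕ< k⁺<n , Fin.toℕ-fromℕ< k⁺<n)
  where
  k⁺<n : toℕ₁ k ℕ.< n
  k⁺<n = ℕ.≤∧≢⇒< (Fin.toℕ<n k) ¬last

+-≢0 : ∀ {x y} → x + y ≢ 0ℤ → x ≢ 0ℤ ⊎ y ≢ 0ℤ
+-≢0 {x} {y} x+y≢0 with x ℤ.≟ 0ℤ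
... | yes refl = inj₂ (λ y≡0 → x+y≢0 (trans (ℤ.+-identityˡ y) y≡0))
... | no  x≢0  = inj₁ x≢0

unique-by-positions : ∀ {m} {k : Fin m} (a : Fin 7) j C bs → Unique (a ∷ proj₂ j ∷ map proj₂ C ++ bs) →
                      Unique ((k , a) ∷ j ∷ C ++ map (k ,_) bs)
unique-by-positions {k = k} a j C bs u =
  AllPairs.map (λ a≢ eq → a≢ (cong proj₂ eq)) (AllPairs.map⁻ (subst Unique positions u))
  where
  positions : a ∷ proj₂ j ∷ map proj₂ C ++ bs ≡ map proj₂ ((k , a) ∷ j ∷ C ++ map (k ,_) bs)
  positions = cong (λ ps → a ∷ proj₂ j ∷ ps)
    (trans (cong (map proj₂ C ++_) (trans (sym (map-id bs)) (map-∘ {g = proj₂} {f = k ,_} bs)))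
           (sym (map-++ proj₂ C _)))

module HakenLubyInstance (n : ℕ) where
  open VCSPNotions (_≟HL_ {n}) (HLvars n) (HakenLuby n)
  open OrientationCriterion (_≟HL_ {n}) (HLvars n) (HakenLuby n)
  open BVCSP (HakenLuby n)

  binary-symmetric : ∀ i j → binary i j ≡ binary j i
  binary-symmetric i j = ℤ.+-comm (HLtable n i j) (HLtable n j i)

  binary-within : ∀ k a b → binary (k , a) (k , b) ≡ blockWeight n (toℕ₁ k) a b
  binary-within k a b = trans (cong₂ _+_ (HLtableℕ-within n (toℕ₁ k) (toℕ₁ a) (toℕ₁ b))
                                         (HLtableℕ-within n (toℕ₁ k) (toℕ₁ b) (toℕ₁ a)))
                              (HLlocal-symmetrised n (toℕ₁ k) a b)

  binary-down : ∀ {k k⁻} → toℕ k ≡ suc (toℕ k⁻) → binary (k , p₇) (k⁻ , p₁) ≡ M (toℕ₁ k) * KK n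
  binary-down {k} {k⁻} k≡k⁻+1 rewrite k≡k⁻+1 =
    trans (cong₂ _+_ (HLtableℕ-down n (toℕ₁ k⁻)) reverse≡0) (ℤ.+-identityʳ _)
    where
    reverse≡0 : HLtableℕ n (toℕ₁ k⁻) 1 (suc (toℕ₁ k⁻)) 7 ≡ 0ℤ
    reverse≡0 = decidable-stable (HLtableℕ n (toℕ₁ k⁻) 1 (suc (toℕ₁ k⁻)) 7 ℤ.≟ 0ℤ) λ w≢0 →
      case HLtableℕ-across-support {n} {toℕ₁ k⁻} {suc (toℕ₁ k⁻)} {1} {7} (ℕ.1+n≢n ∘ sym) w≢0 of λ ()

  binary-up : ∀ {k k⁺} → toℕ k⁺ ≡ toℕ₁ k → binary (k , p₁) (k⁺ , p₇) ≡ (+ 6 * M (toℕ₁ k) + + 25) * KK n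
  binary-up {k} {k⁺} k⁺≡k+1 = begin
    binary (k , p₁) (k⁺ , p₇)         ≡⟨ binary-symmetric (k , p₁) (k⁺ , p₇) ⟩
    binary (k⁺ , p₇) (k , p₁)         ≡⟨ binary-down k⁺≡k+1 ⟩
    M (toℕ₁ k⁺) * KK n                ≡⟨ cong (λ t → M (suc t) * KK n) k⁺≡k+1 ⟩
    M (suc (toℕ₁ k)) * KK n           ≡⟨ cong (_* KK n) (M-step (toℕ k)) ⟩
    (+ 6 * M (toℕ₁ k) + + 25) * KK n  ∎
    where open ≡-Reasoning

  data Adjacent : HLVar n → HLVar n → Set where
    within : ∀ {k a b} → b ∈ blockNeighbours a → Adjacent (k , a) (k , b)
    down   : ∀ {k k′} → toℕ k ≡ suc (toℕ k′) → Adjacent (k , p₇) (k′ , p₁)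
    up     : ∀ {k k′} → toℕ k′ ≡ suc (toℕ k) → Adjacent (k , p₁) (k′ , p₇)

  binary-support : ∀ i j → binary i j ≢ 0ℤ → Adjacent i j
  binary-support (k , a) (k′ , b) c≢0 with k′ Fin.≟ k
  ... | yes refl = within (blockWeight-support λ w≡0 → c≢0 (trans (binary-within k a b) w≡0))
  ... | no  k′≢k with +-≢0 c≢0
  ...   | inj₁ w≢0
          with a≡7 , b≡1 , k≡k′+1 ← HLtableℕ-across-support (k′≢k ∘ sym ∘ toℕ₁-injective) w≢0
          with refl ← toℕ₁-injective {a = a} {p₇} a≡7 | refl ← toℕ₁-injective {a = b} {p₁} b≡1
          = down (ℕ.suc-injective k≡k′+1)
  ...   | inj₂ w≢0
          with b≡7 , a≡1 , k′≡k+1 ← HLtableℕ-across-support (k′≢k ∘ toℕ₁-injective) w≢0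
          with refl ← toℕ₁-injective {a = b} {p₇} b≡7 | refl ← toℕ₁-injective {a = a} {p₁} a≡1
          = up (ℕ.suc-injective k′≡k+1)

  addBlockTerms : Assignment (HLVar n) → Fin n → Fin 7 → ℤ → List (Fin 7) → ℤ
  addBlockTerms x k a = foldl (λ s b → s + bit (x (k , b)) * blockWeight n (toℕ₁ k) a b)

  effUnary-blockwise : ∀ {k a j} (C : List (HLVar n)) (bs : List (Fin 7)) →
                       True (unique? (a ∷ proj₂ j ∷ map proj₂ C ++ bs)) →
                       (∀ {l} → Adjacent (k , a) l → l ∈ j ∷ C ++ map (k ,_) bs) →
                       ∀ x → effUnary x (k , a) j ≡
                             addBlockTerms x k a
                               (foldl (λ s l → s + bit (x l) * binary (k , a) l) (unary (k , a)) C) bs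
  effUnary-blockwise {k} {a} {j} C bs distinct support x = begin
    effUnary x (k , a) j
      ≡⟨ effUnary-support HLvars-unique HLvars-complete
                          (unique-by-positions a j C bs (toWitness distinct))
                          (λ l → support ∘ binary-support (k , a) l) x ⟩
    foldl f (unary (k , a)) (C ++ map (k ,_) bs)
      ≡⟨ foldl-++ f _ C _ ⟩
    foldl f (foldl f (unary (k , a)) C) (map (k ,_) bs)
      ≡⟨ foldl-map f (k ,_) _ bs ⟩
    foldl (λ s b → f s (k , b)) (foldl f (unary (k , a)) C) bs
      ≡⟨ foldl-cong (λ s b → cong (λ c → s + bit (x (k , b)) * c) (binary-within k a b)) _ bs ⟩
    addBlockTerms x k a (foldl f (unary (k , a)) C) bs ∎
    where
    open ≡-Reasoning
    f : ℤ → HLVar n → ℤ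
    f s l = s + bit (x l) * binary (k , a) l
    HLvars-unique : Unique (HLvars n)
    HLvars-unique = cartesianProduct⁺ (allFin⁺ n) (allFin⁺ 7)
    HLvars-complete : ∀ l → l ∈ HLvars n
    HLvars-complete (k , a) = ∈-cartesianProduct⁺ (∈-allFin k) (∈-allFin a)

  neighbours-interior : ∀ {k a b l} → a ≢ p₁ → a ≢ p₇ → Adjacent (k , a) l →
                        l ∈ map (k ,_) (b ∷ otherNeighbours a b)
  neighbours-interior {k} {a} {b} _ _ (within b′∈) = ∈-map⁺ (k ,_) (∈-otherNeighbours {a} {b} b′∈)
  neighbours-interior _ a≢p₇ (down _) = ⊥-elim (a≢p₇ refl)
  neighbours-interior a≢p₁ _ (up _)   = ⊥-elim (a≢p₁ refl)

  stable-interior : ∀ k a b → a ≢ p₁ → a ≢ p₇ → True (unique? (a ∷ b ∷ otherNeighbours a b)) →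
                    (∀ x → ¬ Overrides (blockWeight n (toℕ₁ k) a b)
                                       (addBlockTerms x k a (unary (k , a)) (otherNeighbours a b))) →
                    Stable (k , a) (k , b)
  stable-interior k a b a≢p₁ a≢p₇ distinct = stable-from (k , a) (k , b) (binary-within k a b)
    (effUnary-blockwise [] (otherNeighbours a b) distinct (neighbours-interior a≢p₁ a≢p₇))

  unary-first-last : ∀ {k} → toℕ₁ k ≡ n → unary (k , p₁) ≡ (+ 6 * M (toℕ₁ k) + + 24) * KK n
  unary-first-last {k} last with toℕ₁ k ≡ᵇ n in eq
  ... | true  = refl
  ... | false = ⊥-elim (subst T eq (ℕ.≡⇒≡ᵇ _ _ last))

  unary-first-inner : ∀ {k} {k⁺ : Fin n} → toℕ k⁺ ≡ toℕ₁ k →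
                      unary (k , p₁) ≡ - ((+ 6 * M (toℕ₁ k) + + 24) * KK n)
  unary-first-inner {k} {k⁺} k⁺≡k+1 with toℕ₁ k ≡ᵇ n in eq
  ... | true  = ⊥-elim (ℕ.<⇒≢ (Fin.toℕ<n k⁺) (trans k⁺≡k+1 (≡ᵇ⇒≡ eq)))
  ... | false = refl

  neighbours-first-last : ∀ {k b l} → toℕ₁ k ≡ n → Adjacent (k , p₁) l →
                          l ∈ map (k ,_) (b ∷ otherNeighbours p₁ b)
  neighbours-first-last {k} {b} _ (within b′∈) = ∈-map⁺ (k ,_) (∈-otherNeighbours {p₁} {b} b′∈)
  neighbours-first-last last (up {k′ = k′} eq) = ⊥-elim (ℕ.<⇒≢ (Fin.toℕ<n k′) (trans eq last))

  neighbours-first-inner : ∀ {k k⁺ b l} → toℕ k⁺ ≡ toℕ₁ k → Adjacent (k , p₁) l →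
                           l ∈ (k , b) ∷ (k⁺ , p₇) ∷ map (k ,_) (otherNeighbours p₁ b)
  neighbours-first-inner {k} {b = b} _ (within b′∈) with ∈-otherNeighbours {p₁} {b} b′∈
  ... | here refl      = here refl
  ... | there b′∈other = there (there (∈-map⁺ (k ,_) b′∈other))
  neighbours-first-inner k⁺≡k+1 (up eq) with refl ← Fin.toℕ-injective (trans eq (sym k⁺≡k+1)) =
    there (here refl)

  stable-first : ∀ k b → True (unique? (p₁ ∷ b ∷ otherNeighbours p₁ b)) →
                 True (unique? (p₁ ∷ b ∷ p₇ ∷ otherNeighbours p₁ b)) →
                 (toℕ₁ k ≡ n → ∀ x → ¬ Overrides (blockWeight n (toℕ₁ k) p₁ b)
                   (addBlockTerms x k p₁ ((+ 6 * M (toℕ₁ k) + + 24) * KK n) (otherNeighbours p₁ b))) →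
                 (∀ {k⁺} → toℕ k⁺ ≡ toℕ₁ k → ∀ x → ¬ Overrides (blockWeight n (toℕ₁ k) p₁ b)
                   (addBlockTerms x k p₁ (- ((+ 6 * M (toℕ₁ k) + + 24) * KK n)
                                          + bit (x (k⁺ , p₇)) * ((+ 6 * M (toℕ₁ k) + + 25) * KK n))
                                         (otherNeighbours p₁ b))) →
                 Stable (k , p₁) (k , b)
  stable-first k b distinct distinct⁺ bound-last bound-inner with last-or-successor k
  ... | inj₁ last = stable-from (k , p₁) (k , b) (binary-within k p₁ b) (λ x →
          trans (effUnary-blockwise [] (otherNeighbours p₁ b) distinct (neighbours-first-last last) x)
                (cong (λ u → addBlockTerms x k p₁ u (otherNeighbours p₁ b)) (unary-first-last last)))
          (bound-last last)
  ... | inj₂ (k⁺ , k⁺≡k+1) = stable-from (k , p₁) (k , b) (binary-within k p₁ b) (λ x →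
          trans (effUnary-blockwise ((k⁺ , p₇) ∷ []) (otherNeighbours p₁ b) distinct⁺
                                    (neighbours-first-inner k⁺≡k+1) x)
                (cong (λ u → addBlockTerms x k p₁ u (otherNeighbours p₁ b))
                      (cong₂ (λ u c → u + bit (x (k⁺ , p₇)) * c)
                             (unary-first-inner k⁺≡k+1) (binary-up k⁺≡k+1))))
          (bound-inner k⁺≡k+1)

  neighbours-seventh : ∀ {k k⁻ l} → toℕ k ≡ suc (toℕ k⁻) → Adjacent (k , p₇) l →
                       l ∈ (k⁻ , p₁) ∷ map (k ,_) (blockNeighbours p₇)
  neighbours-seventh {k} _ (within b∈) = there (∈-map⁺ (k ,_) b∈)
  neighbours-seventh k≡k⁻+1 (down eq)
    with refl ← Fin.toℕ-injective (ℕ.suc-injective (trans (sym eq) k≡k⁻+1)) = here refl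

  module BlockBounds (k : Fin n) =
    EffectiveUnaryBounds (M (toℕ₁ k)) (KK n) (eps n (toℕ₁ k))
                         (+≤+ z≤n) (0<KK n) (0<eps k) (eps≤KK n (toℕ₁ k))

  stable₁₂ : ∀ k → Stable (k , p₁) (k , p₂)
  stable₁₂ k = stable-first k p₂ _ _ (λ _ x → no-override₁₂-last (x (k , p₃)))
                                     (λ {k⁺} _ x → no-override₁₂ (x (k⁺ , p₇)) (x (k , p₃)))
    where open BlockBounds k

  stable₁₃ : ∀ k → Stable (k , p₁) (k , p₃)
  stable₁₃ k = stable-first k p₃ _ _ (λ _ x → no-override₁₃-last (x (k , p₂)))
                                     (λ {k⁺} _ x → no-override₁₃ (x (k⁺ , p₇)) (x (k , p₂)))
    where open BlockBounds k

  stable₂₄ : ∀ k → Stable (k , p₂) (k , p₄)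
  stable₂₄ k = stable-interior k p₂ p₄ (λ ()) (λ ()) _ λ x → no-override₂₄ (x (k , p₁))
    where open BlockBounds k

  stable₃₆ : ∀ k → Stable (k , p₃) (k , p₆)
  stable₃₆ k = stable-interior k p₃ p₆ (λ ()) (λ ()) _ λ x → no-override₃₆ (x (k , p₁))
    where open BlockBounds k

  stable₄₅ : ∀ k → Stable (k , p₄) (k , p₅)
  stable₄₅ k = stable-interior k p₄ p₅ (λ ()) (λ ()) _ λ x → no-override₄₅ (x (k , p₂)) (x (k , p₇))
    where open BlockBounds k

  stable₆₅ : ∀ k → Stable (k , p₆) (k , p₅)
  stable₆₅ k = stable-interior k p₆ p₅ (λ ()) (λ ()) _ λ x → no-override₄₅ (x (k , p₃)) (x (k , p₇))
    where open BlockBounds k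

  stable₄₇ : ∀ k → Stable (k , p₄) (k , p₇)
  stable₄₇ k = stable-interior k p₄ p₇ (λ ()) (λ ()) _ λ x → no-override₄₇ (x (k , p₂)) (x (k , p₅))
    where open BlockBounds k

  stable₆₇ : ∀ k → Stable (k , p₆) (k , p₇)
  stable₆₇ k = stable-interior k p₆ p₇ (λ ()) (λ ()) _ λ x → no-override₄₇ (x (k , p₃)) (x (k , p₅))
    where open BlockBounds k

  stable₅₇ : ∀ k → Stable (k , p₅) (k , p₇)
  stable₅₇ k = stable-interior k p₅ p₇ (λ ()) (λ ()) _ λ x → no-override₅₇ (x (k , p₄)) (x (k , p₆))
    where open BlockBounds k

  stable₇₁ : ∀ {k k⁻} → toℕ k ≡ suc (toℕ k⁻) → Stable (k , p₇) (k⁻ , p₁)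
  stable₇₁ {k} {k⁻} k≡k⁻+1 = stable-from (k , p₇) (k⁻ , p₁) (binary-down k≡k⁻+1)
    (effUnary-blockwise [] (blockNeighbours p₇) _ (neighbours-seventh k≡k⁻+1))
    λ x → no-override₇₁ (x (k , p₄)) (x (k , p₅)) (x (k , p₆))
    where open BlockBounds k

  stable-in-block : ∀ k {a b} → b ∈ blockNeighbours a → Stable (k , a) (k , b) ⊎ Stable (k , b) (k , a)
  stable-in-block k {p₁} (here refl)                 = inj₁ (stable₁₂ k)
  stable-in-block k {p₁} (there (here refl))         = inj₁ (stable₁₃ k)
  stable-in-block k {p₂} (here refl)                 = inj₂ (stable₁₂ k)
  stable-in-block k {p₂} (there (here refl))         = inj₁ (stable₂₄ k)
  stable-in-block k {p₃} (here refl)                 = inj₂ (stable₁₃ k)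
  stable-in-block k {p₃} (there (here refl))         = inj₁ (stable₃₆ k)
  stable-in-block k {p₄} (here refl)                 = inj₂ (stable₂₄ k)
  stable-in-block k {p₄} (there (here refl))         = inj₁ (stable₄₅ k)
  stable-in-block k {p₄} (there (there (here refl))) = inj₁ (stable₄₇ k)
  stable-in-block k {p₅} (here refl)                 = inj₂ (stable₄₅ k)
  stable-in-block k {p₅} (there (here refl))         = inj₂ (stable₆₅ k)
  stable-in-block k {p₅} (there (there (here refl))) = inj₁ (stable₅₇ k)
  stable-in-block k {p₆} (here refl)                 = inj₂ (stable₃₆ k)
  stable-in-block k {p₆} (there (here refl))         = inj₁ (stable₆₅ k)
  stable-in-block k {p₆} (there (there (here refl))) = inj₁ (stable₆₇ k)
  stable-in-block k {p₇} (here refl)                 = inj₂ (stable₄₇ k)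
  stable-in-block k {p₇} (there (here refl))         = inj₂ (stable₅₇ k)
  stable-in-block k {p₇} (there (there (here refl))) = inj₂ (stable₆₇ k)

  stable-endpoint : ∀ i j → Edge i j → Stable i j ⊎ Stable j i
  stable-endpoint i j (_ , c≢0) with binary-support i j c≢0
  ... | within b∈ = stable-in-block _ b∈
  ... | down eq   = inj₁ (stable₇₁ eq)
  ... | up eq     = inj₂ (stable₇₁ eq)

  oriented : Oriented
  oriented = oriented-if-stable-endpoints binary-symmetric stable-endpoint

-- The hypothesis 1 ≤ n is unused: the argument works for every n, including the empty instance.
proposition6p1 : (n : ℕ) → 1 ≤ n → IsOriented n
proposition6p1 n _ = HakenLubyInstance.oriented n
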